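{- For every integer $n\ge 10$ there exists a graph on $n$ vertices whose interlace polynomial $q$ has a non-unimodal coefficient sequence. (In particular, the conjecture that the coefficient sequence of $q(G)$ is unimodal for every graph $G$ is false.)
   Context: All graphs are finite, simple and undirected. For a vertex $u$, $G\setminus u$ denotes $G$ with $u$ and all edges incident to $u$ removed. Local complementation (LC) at a vertex $u$ transforms $G$ into $G*u$ by replacing the induced subgraph on the neighbourhood $N_u$ of $u$ by its complement. For an edge $\{u,v\}$, edge local complementation gives $G^{(uv)} = G*u*v*u$. The interlace polynomial $q(G)=q(G,x)$ is defined recursively: for the edgeless graph $E_n$ on $n$ vertices, $q(E_n)=x^n$; for any other graph choose an edge $\{u,v\}$ and set $q(G) = q(G\setminus u) + q(G^{(uv)}\setminus u)$ (this is known to be independent of the choice of edge). If $q(G)=a_1x+a_2x^2+\cdots+a_dx^d$ with $d=\deg q(G)$, its coefficient sequence is $(a_1,\dots,a_d)$; a sequence $(a_1,\dots,a_d)$ is unimodal if there is $1\le k\le d$ with $a_i\le a_j$ for all $i<j\le k$ and $a_i\ge a_j$ for all $i>j\ge k$. -}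

module Defs where

open import Data.Bool using (Bool; true; false; _∧_; not; _xor_; if_then_else_)
open import Data.Nat using (ℕ; zero; suc; _+_; _≤_; _<_)
open import Data.Fin using (Fin; punchIn) renaming (_≟_ to _≟ᶠ_; _≤_ to _≤ᶠ_; _<_ to _<ᶠ_)
open import Data.List using (List; []; _∷_; length; lookup; allFin; cartesianProductWith; replicate; _++_; reverse; drop)
open import Data.Maybe using (Maybe; just; nothing)
open import Data.Product using (Σ; _×_; _,_)
open import Relation.Nullary.Decidable using (⌊_⌋)
open import Relation.Binary.PropositionalEquality using (_≡_)

record SimpleGraph (n : ℕ) : Set where
  field
    adj    : Fin n → Fin n → Bool
    sym    : ∀ i j → adj i j ≡ adj j i
    irrefl : ∀ i → adj i i ≡ false
open SimpleGraph public

-- Raw adjacency "matrices" (the recursion below only ever produces simple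
-- graphs from simple graphs).
Adj : ℕ → Set
Adj n = Fin n → Fin n → Bool

deleteV : ∀ {n} → Adj (suc n) → Fin (suc n) → Adj n
deleteV A u i j = A (punchIn u i) (punchIn u j)

-- Local complementation G * u: complement the induced subgraph on N_u.
lc : ∀ {n} → Adj n → Fin n → Adj n
lc A u a b = A a b xor (A u a ∧ A u b ∧ not ⌊ a ≟ᶠ b ⌋)

elc : ∀ {n} → Adj n → Fin n → Fin n → Adj n
elc A u v = lc (lc (lc A u) v) u

-- Polynomials in x with natural coefficients: coefficient list, x^0 first.
Poly : Set
Poly = List ℕ

_⊕_ : Poly → Poly → Poly
[] ⊕ q = q
(a ∷ p) ⊕ [] = a ∷ p
(a ∷ p) ⊕ (b ∷ q) = (a + b) ∷ (p ⊕ q)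

xPow : ℕ → Poly
xPow k = replicate k 0 ++ (1 ∷ [])

firstJust : ∀ {X : Set} → List (Maybe X) → Maybe X
firstJust [] = nothing
firstJust (just x ∷ _) = just x
firstJust (nothing ∷ xs) = firstJust xs

findEdge : ∀ {n} → Adj n → Maybe (Fin n × Fin n)
findEdge {n} A = firstJust (cartesianProductWith
  (λ u v → if A u v then just (u , v) else nothing) (allFin n) (allFin n))

-- Interlace polynomial: q(E_n) = x^n; otherwise, for an edge {u,v},
-- q(G) = q(G \ u) + q(G^(uv) \ u).  (Independent of the edge chosen; we fix
-- the first edge found.)
interlace : ∀ n → Adj n → Poly
interlace zero A = xPow 0
interlace (suc n) A with findEdge A
... | nothing = xPow (suc n)
... | just (u , v) = interlace n (deleteV A u) ⊕ interlace n (deleteV (elc A u v) u)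

q : ∀ {n} → SimpleGraph n → Poly
q {n} G = interlace n (adj G)

-- Remove trailing zero coefficients (so the last entry is the leading one).
dropLeadingZeros : List ℕ → List ℕ
dropLeadingZeros [] = []
dropLeadingZeros (zero ∷ xs) = dropLeadingZeros xs
dropLeadingZeros (suc k ∷ xs) = suc k ∷ xs

trim : Poly → Poly
trim p = reverse (dropLeadingZeros (reverse p))

-- Coefficient sequence (a_1, ..., a_d), d = deg q.
coeffSeq : Poly → List ℕ
coeffSeq p = drop 1 (trim p)

Unimodal : List ℕ → Set
Unimodal as = Σ (Fin (length as)) λ k →
  (∀ i j → i <ᶠ j → j ≤ᶠ k → lookup as i ≤ lookup as j) ×
  (∀ i j → j <ᶠ i → k ≤ᶠ j → lookup as i ≤ lookup as j)

-- Adding an isolated vertex multiplies the interlace polynomial by x, i.e. shifts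
-- its coefficient list by one place. So it suffices to exhibit one graph on 10
-- vertices with non-unimodal coefficients: the graph below has
-- q = 2x + 7x² + 6x³ + 7x⁴ + 4x⁵ + 3x⁶ + 2x⁷ + x⁸, computed by evaluation, whose
-- coefficients dip from 7 to 6 and rise back to 7. Padding it with n − 10
-- isolated vertices gives the graphs on n vertices.
module Submission where

open import Defs hiding (sym)
open import Data.Bool using (Bool; true; false; _∨_; if_then_else_)
open import Data.Bool.Properties using (∨-comm; ∧-zeroʳ)
open import Data.Fin using (Fin; zero; suc; toℕ) renaming (_≤?_ to _≤ᶠ?_; _≟_ to _≟ᶠ_)
open import Data.Fin.Properties using (suc-injective)
open import Data.List using (List; []; _∷_; _++_; map; replicate; reverse; length; lookup; tabulate; allFin; cartesianProductWith)
open import Data.List.Properties using (map-∘; map-cong; map-tabulate; reverse-++; reverse-involutive)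
open import Data.Maybe using (Maybe; just; nothing; _<∣>_) renaming (map to mapᴹ)
open import Data.Maybe.Properties using (map-<∣>)
open import Data.Nat using (ℕ; zero; suc; _+_; _∸_; _≤_; _<_; z≤n; s≤s)
open import Data.Nat.Properties using (<⇒≱; ≰⇒≥; n<1+n; m∸n+n≡m)
import Data.Product as ×
open import Data.Product using (Σ; _×_; _,_)
open import Function using (id; _∘_)
open import Relation.Nullary using (¬_; yes; no)
open import Relation.Nullary.Decidable using (⌊⌋-map′)
open import Relation.Binary.PropositionalEquality

private
  variable
    n : ℕ
    X Y : Set

firstJust-++ : (xs ys : List (Maybe X)) → firstJust (xs ++ ys) ≡ firstJust xs <∣> firstJust ys
firstJust-++ []             ys = refl
firstJust-++ (just x ∷ xs)  ys = refl
firstJust-++ (nothing ∷ xs) ys = firstJust-++ xs ys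

firstJust-map : (h : X → Y) (xs : List (Maybe X)) → firstJust (map (mapᴹ h) xs) ≡ mapᴹ h (firstJust xs)
firstJust-map h []             = refl
firstJust-map h (just x ∷ xs)  = refl
firstJust-map h (nothing ∷ xs) = firstJust-map h xs

firstJust-nothing : (f : Y → Maybe X) (ys : List Y) → (∀ y → f y ≡ nothing) → firstJust (map f ys) ≡ nothing
firstJust-nothing f []       f≡nothing = refl
firstJust-nothing f (y ∷ ys) f≡nothing rewrite f≡nothing y = firstJust-nothing f ys f≡nothing

edgeAt : Adj n → Fin n → Fin n → Maybe (Fin n × Fin n)
edgeAt A u v = if A u v then just (u , v) else nothing

edgeAt-nonadjacent : ∀ (A : Adj n) {u v} → A u v ≡ false → edgeAt A u v ≡ nothing
edgeAt-nonadjacent A A≡false rewrite A≡false = refl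

-- Stated pointwise
-- rather than as A = addIsolatedAdj B, since local complementation and deletion
-- preserve it only up to pointwise equality.
record IsolatedZero (A : Adj (suc n)) (B : Adj n) : Set where
  field
    row-zero : ∀ j → A zero j ≡ false
    col-zero : ∀ i → A i zero ≡ false
    suc-suc  : ∀ i j → A (suc i) (suc j) ≡ B i j
open IsolatedZero

sucEdge : Fin n × Fin n → Fin (suc n) × Fin (suc n)
sucEdge = ×.map suc suc

module _ {A : Adj (suc n)} {B : Adj n} (iz : IsolatedZero A B) where

  edgeAt-suc : ∀ u v → edgeAt A (suc u) (suc v) ≡ mapᴹ sucEdge (edgeAt B u v)
  edgeAt-suc u v rewrite suc-suc iz u v with B u v
  ... | true  = refl
  ... | false = refl

  firstJust-sucRows : ∀ xs ys →
    firstJust (cartesianProductWith (edgeAt A) (map suc xs) (zero ∷ map suc ys))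
      ≡ mapᴹ sucEdge (firstJust (cartesianProductWith (edgeAt B) xs ys))
  firstJust-sucRows []       ys = refl
  firstJust-sucRows (x ∷ xs) ys = begin
    firstJust (edgeAt A (suc x) zero ∷ row ++ rest)
      ≡⟨ cong (λ e → firstJust (e ∷ row ++ rest)) (edgeAt-nonadjacent A (col-zero iz (suc x))) ⟩
    firstJust (row ++ rest)
      ≡⟨ firstJust-++ row rest ⟩
    firstJust row <∣> firstJust rest
      ≡⟨ cong₂ _<∣>_ (cong firstJust row≡) (firstJust-sucRows xs ys) ⟩
    firstJust (map (mapᴹ sucEdge) rowB) <∣> mapᴹ sucEdge (firstJust restB)
      ≡⟨ cong (_<∣> _) (firstJust-map sucEdge rowB) ⟩
    mapᴹ sucEdge (firstJust rowB) <∣> mapᴹ sucEdge (firstJust restB)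
      ≡⟨ sym (map-<∣> sucEdge (firstJust rowB) (firstJust restB)) ⟩
    mapᴹ sucEdge (firstJust rowB <∣> firstJust restB)
      ≡⟨ cong (mapᴹ sucEdge) (sym (firstJust-++ rowB restB)) ⟩
    mapᴹ sucEdge (firstJust (rowB ++ restB))
      ∎
    where
    open ≡-Reasoning
    row   = map (edgeAt A (suc x)) (map suc ys)
    rest  = cartesianProductWith (edgeAt A) (map suc xs) (zero ∷ map suc ys)
    rowB  = map (edgeAt B x) ys
    restB = cartesianProductWith (edgeAt B) xs ys
    row≡ : row ≡ map (mapᴹ sucEdge) rowB
    row≡ = trans (sym (map-∘ ys)) (trans (map-cong (edgeAt-suc x) ys) (map-∘ ys))

  findEdge-isolatedZero : findEdge A ≡ mapᴹ sucEdge (findEdge B)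
  findEdge-isolatedZero = begin
    firstJust (row₀ ++ rest)
      ≡⟨ firstJust-++ row₀ rest ⟩
    firstJust row₀ <∣> firstJust rest
      ≡⟨ cong (_<∣> firstJust rest) (firstJust-nothing (edgeAt A zero) (allFin (suc n)) (edgeAt-nonadjacent A ∘ row-zero iz)) ⟩
    firstJust rest
      ≡⟨ cong (λ vs → firstJust (cartesianProductWith (edgeAt A) vs (zero ∷ vs))) (sym (map-tabulate id suc)) ⟩
    firstJust (cartesianProductWith (edgeAt A) (map suc (allFin n)) (zero ∷ map suc (allFin n)))
      ≡⟨ firstJust-sucRows (allFin n) (allFin n) ⟩
    mapᴹ sucEdge (findEdge B)
      ∎
    where
    open ≡-Reasoning
    row₀ = map (edgeAt A zero) (allFin (suc n))
    rest = cartesianProductWith (edgeAt A) (tabulate suc) (allFin (suc n))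

lc-isolatedZero : {A : Adj (suc n)} {B : Adj n} → IsolatedZero A B → ∀ w → IsolatedZero (lc A (suc w)) (lc B w)
row-zero (lc-isolatedZero iz w) j rewrite row-zero iz j | col-zero iz (suc w) = refl
col-zero (lc-isolatedZero {A = A} iz w) i rewrite col-zero iz i | col-zero iz (suc w) = ∧-zeroʳ (A (suc w) i)
suc-suc  (lc-isolatedZero iz w) i j
  rewrite suc-suc iz i j | suc-suc iz w i | suc-suc iz w j | ⌊⌋-map′ (cong suc) suc-injective (i ≟ᶠ j) = refl

elc-isolatedZero : {A : Adj (suc n)} {B : Adj n} → IsolatedZero A B → ∀ u v → IsolatedZero (elc A (suc u) (suc v)) (elc B u v)
elc-isolatedZero iz u v = lc-isolatedZero (lc-isolatedZero (lc-isolatedZero iz u) v) u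

deleteV-isolatedZero : {A : Adj (suc (suc n))} {B : Adj (suc n)} → IsolatedZero A B → ∀ u → IsolatedZero (deleteV A (suc u)) (deleteV B u)
row-zero (deleteV-isolatedZero iz u) j   = row-zero iz _
col-zero (deleteV-isolatedZero iz u) i   = col-zero iz _
suc-suc  (deleteV-isolatedZero iz u) i j = suc-suc iz _ _

interlace-isolatedZero : ∀ n {A : Adj (suc n)} {B : Adj n} → IsolatedZero A B → interlace (suc n) A ≡ 0 ∷ interlace n B
interlace-isolatedZero zero {A} iz with findEdge A | findEdge-isolatedZero iz
... | nothing | _ = refl
interlace-isolatedZero (suc n) {A} {B} iz with findEdge A | findEdge B | findEdge-isolatedZero iz
... | nothing | nothing      | _    = refl
... | just _  | just (u , v) | refl =
  cong₂ _⊕_ (interlace-isolatedZero n (deleteV-isolatedZero iz u))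
            (interlace-isolatedZero n (deleteV-isolatedZero (elc-isolatedZero iz u v) u))

addIsolatedAdj : Adj n → Adj (suc n)
addIsolatedAdj A zero    _       = false
addIsolatedAdj A (suc i) zero    = false
addIsolatedAdj A (suc i) (suc j) = A i j

addIsolated : SimpleGraph n → SimpleGraph (suc n)
addIsolated G = record { adj = addIsolatedAdj (adj G) ; sym = adj-sym ; irrefl = adj-irrefl }
  where
  adj-sym : ∀ i j → addIsolatedAdj (adj G) i j ≡ addIsolatedAdj (adj G) j i
  adj-sym zero    zero    = refl
  adj-sym zero    (suc j) = refl
  adj-sym (suc i) zero    = refl
  adj-sym (suc i) (suc j) = Defs.sym G i j
  adj-irrefl : ∀ i → addIsolatedAdj (adj G) i i ≡ false
  adj-irrefl zero    = refl
  adj-irrefl (suc i) = irrefl G i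

q-addIsolated : (G : SimpleGraph n) → q (addIsolated G) ≡ 0 ∷ q G
q-addIsolated {n} G = interlace-isolatedZero n {A = addIsolatedAdj (adj G)} {B = adj G} record
  { row-zero = λ _ → refl
  ; col-zero = λ { zero → refl ; (suc _) → refl }
  ; suc-suc  = λ _ _ → refl
  }

addIsolateds : ∀ m → SimpleGraph n → SimpleGraph (m + n)
addIsolateds zero    G = G
addIsolateds (suc m) G = addIsolated (addIsolateds m G)

q-addIsolateds : ∀ m (G : SimpleGraph n) → q (addIsolateds m G) ≡ replicate m 0 ++ q G
q-addIsolateds zero    G = refl
q-addIsolateds (suc m) G = trans (q-addIsolated (addIsolateds m G)) (cong (0 ∷_) (q-addIsolateds m G))

Unimodal-tail : ∀ {a b} l → Unimodal (a ∷ b ∷ l) → Unimodal (b ∷ l)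
Unimodal-tail l (zero , _ , right) =
  zero , (λ { _ zero () _ ; _ (suc _) _ () }) , λ i j j<i _ → right (suc i) (suc j) (s≤s j<i) z≤n
Unimodal-tail l (suc k , left , right) =
  k , (λ i j i<j j≤k → left (suc i) (suc j) (s≤s i<j) (s≤s j≤k))
    , (λ i j j<i k≤j → right (suc i) (suc j) (s≤s j<i) (s≤s k≤j))

Unimodal-++⁻ʳ : ∀ xs {y ys} → Unimodal (xs ++ y ∷ ys) → Unimodal (y ∷ ys)
Unimodal-++⁻ʳ []            u = u
Unimodal-++⁻ʳ (x ∷ [])      u = Unimodal-tail _ u
Unimodal-++⁻ʳ (x ∷ x′ ∷ xs) u = Unimodal-++⁻ʳ (x′ ∷ xs) (Unimodal-tail _ u)

valley⇒¬Unimodal : ∀ {as} (i j k : Fin (length as)) → toℕ i < toℕ j → toℕ j < toℕ k →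
  lookup as j < lookup as i → lookup as j < lookup as k → ¬ Unimodal as
valley⇒¬Unimodal i j k i<j j<k ai>aj ak>aj (mode , left , right) with j ≤ᶠ? mode
... | yes j≤mode = <⇒≱ ai>aj (left i j i<j j≤mode)
... | no  j≰mode = <⇒≱ ak>aj (right k j j<k (≰⇒≥ j≰mode))

trim-id : ∀ p {k zs} → reverse p ≡ suc k ∷ zs → trim p ≡ p
trim-id p {k} {zs} rev≡ = begin
  reverse (dropLeadingZeros (reverse p)) ≡⟨ cong (reverse ∘ dropLeadingZeros) rev≡ ⟩
  reverse (suc k ∷ zs)                    ≡⟨ cong reverse (sym rev≡) ⟩
  reverse (reverse p)                     ≡⟨ reverse-involutive p ⟩
  p                                       ∎
  where open ≡-Reasoning

valleyEdge : ℕ → ℕ → Bool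
valleyEdge 0 3 = true
valleyEdge 0 6 = true
valleyEdge 1 3 = true
valleyEdge 2 3 = true
valleyEdge 3 4 = true
valleyEdge 3 5 = true
valleyEdge 3 7 = true
valleyEdge 3 8 = true
valleyEdge 5 6 = true
valleyEdge 6 7 = true
valleyEdge 6 8 = true
valleyEdge 6 9 = true
valleyEdge _ _ = false

valleyEdge-irrefl : ∀ k → valleyEdge k k ≡ false
valleyEdge-irrefl 0 = refl
valleyEdge-irrefl 1 = refl
valleyEdge-irrefl 2 = refl
valleyEdge-irrefl 3 = refl
valleyEdge-irrefl 4 = refl
valleyEdge-irrefl 5 = refl
valleyEdge-irrefl 6 = refl
valleyEdge-irrefl 7 = refl
valleyEdge-irrefl 8 = refl
valleyEdge-irrefl 9 = refl
valleyEdge-irrefl (suc (suc (suc (suc (suc (suc (suc (suc (suc (suc k)))))))))) = refl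

valleyGraph : SimpleGraph 10
valleyGraph = record
  { adj    = λ i j → valleyEdge (toℕ i) (toℕ j) ∨ valleyEdge (toℕ j) (toℕ i)
  ; sym    = λ i j → ∨-comm (valleyEdge (toℕ i) (toℕ j)) _
  ; irrefl = λ i → cong (λ b → b ∨ b) (valleyEdge-irrefl (toℕ i))
  }

valleyCoeffs : List ℕ
valleyCoeffs = 2 ∷ 7 ∷ 6 ∷ 7 ∷ 4 ∷ 3 ∷ 2 ∷ 1 ∷ []

q-valleyGraph : q valleyGraph ≡ 0 ∷ valleyCoeffs
q-valleyGraph = refl

¬Unimodal-valleyCoeffs : ¬ Unimodal valleyCoeffs
¬Unimodal-valleyCoeffs = valley⇒¬Unimodal (suc zero) (suc (suc zero)) (suc (suc (suc zero)))
  (n<1+n 1) (n<1+n 2) (n<1+n 6) (n<1+n 6)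

¬Unimodal-coeffSeq-padded : ∀ m → ¬ Unimodal (coeffSeq (replicate m 0 ++ 0 ∷ valleyCoeffs))
¬Unimodal-coeffSeq-padded m u
  rewrite trim-id (replicate m 0 ++ 0 ∷ valleyCoeffs) (reverse-++ (replicate m 0) (0 ∷ valleyCoeffs))
  with m
... | zero  = ¬Unimodal-valleyCoeffs u
... | suc m = ¬Unimodal-valleyCoeffs (Unimodal-tail _ (Unimodal-++⁻ʳ (replicate m 0) u))

mainTheorem2 : ∀ (n : ℕ) → 10 ≤ n → Σ (SimpleGraph n) λ G → ¬ Unimodal (coeffSeq (q G))
mainTheorem2 n 10≤n = subst NonUnimodalOn (m∸n+n≡m 10≤n) (padded (n ∸ 10))
  where
  NonUnimodalOn : ℕ → Set
  NonUnimodalOn k = Σ (SimpleGraph k) λ G → ¬ Unimodal (coeffSeq (q G))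
  padded : ∀ m → NonUnimodalOn (m + 10)
  padded m = addIsolateds m valleyGraph , ¬Unimodal-coeffSeq-padded m ∘ subst (Unimodal ∘ coeffSeq) q≡
    where
    q≡ : q (addIsolateds m valleyGraph) ≡ replicate m 0 ++ 0 ∷ valleyCoeffs
    q≡ = trans (q-addIsolateds m valleyGraph) (cong (replicate m 0 ++_) q-valleyGraph)
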